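{- Cut elimination for simple proof nets of classical logic, i.e., the reduction relation on simple prenets given by the rules (K1) and (K2), preserves correctness, is confluent, and is terminating.
   Context: Classical formulas: over atoms $a$, $\bar a$, $F ::= a\mid\bar a\mid F\vee F\mid F\wedge F$, with negation $\bar{\bar a}=a$, $\overline{A\wedge B}=\bar B\vee\bar A$, $\overline{A\vee B}=\bar B\wedge\bar A$. A simple prenet $\langle P\rangle\Gamma$ is a sequent forest $\Gamma$ (a list of formula trees, possibly with cuts, a cut being a tree with special root $A\oslash\bar A$ whose children are the trees of $A$ and $\bar A$) with a symmetric irreflexive relation $P$ (links) on its leaves relating only occurrences of dual atoms. A conjunctive pruning deletes, for every $\wedge$-node and every cut node, one of its two immediate subtrees, and restricts $P$ to the remaining leaves; $\langle P\rangle\Gamma$ is correct iff every conjunctive pruning retains at least one link. A simple proof net is a correct simple prenet. Cut reduction: (K1) a cut between $A\wedge B$ and $\bar B\vee\bar A$ is replaced by the two cuts $A\oslash\bar A$ and $B\oslash\bar B$ (links unchanged); (K2) for an atomic cut $x\oslash y$ ($x$ an occurrence of $a$, $y$ of $\bar a$), let $X$ be the set of leaves other than $y$ linked to $x$ and $Y$ the set of leaves other than $x$ linked to $y$; remove the cut node, $x$, $y$ and all links involving them, and add a link between every $u\in X$ and every $v\in Y$ (if not already present). "Preserves correctness" means that any reduct of a correct simple prenet is correct. -}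

module Defs where

open import Data.Nat using (ℕ)
open import Data.Bool using (Bool; true; false; not)
open import Data.List using (List; []; _∷_; _++_; [_]; map)
open import Data.List.Membership.Propositional using (_∈_)
open import Data.List.Relation.Unary.All using (All)
open import Data.List.Relation.Unary.Unique.Propositional using (Unique)
open import Data.Product using (_×_; _,_; proj₂; ∃; ∃-syntax)
open import Data.Sum using (_⊎_)
open import Data.Unit using (⊤)
open import Data.Empty using (⊥)
open import Relation.Nullary using (¬_)
open import Relation.Binary.PropositionalEquality using (_≡_; _≢_)
open import Relation.Binary.Construct.Closure.ReflexiveTransitive using (Star)
open import Function using (flip)
open import Induction.WellFounded using (Acc)

-- Literals (atom occurrences): an atom name a : ℕ together with a
-- polarity; (true , a) is a, (false , a) is ā.

record Lit : Set where
  constructor lit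
  field
    pol  : Bool
    atom : ℕ

dualLit : Lit → Lit
dualLit (lit p a) = lit (not p) a

data Form : Set where
  atm  : Lit → Form
  _∨ᶠ_ : Form → Form → Form
  _∧ᶠ_ : Form → Form → Form

dualF : Form → Form
dualF (atm l)  = atm (dualLit l)
dualF (A ∧ᶠ B) = dualF B ∨ᶠ dualF A
dualF (A ∨ᶠ B) = dualF B ∧ᶠ dualF A

-- Formula trees whose leaves carry a leaf name (ℕ) identifying the
-- leaf occurrence.

data Tree : Set where
  leaf : Lit → ℕ → Tree
  _∨ₜ_ : Tree → Tree → Tree
  _∧ₜ_ : Tree → Tree → Tree

shape : Tree → Form
shape (leaf l _) = atm l
shape (t ∨ₜ s)   = shape t ∨ᶠ shape s
shape (t ∧ₜ s)   = shape t ∧ᶠ shape s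

data Root : Set where
  fml : Tree → Root
  cut : Tree → Tree → Root

Forest : Set
Forest = List Root

leavesT : Tree → List (Lit × ℕ)
leavesT (leaf l n) = [ (l , n) ]
leavesT (t ∨ₜ s)   = leavesT t ++ leavesT s
leavesT (t ∧ₜ s)   = leavesT t ++ leavesT s

leavesR : Root → List (Lit × ℕ)
leavesR (fml t)   = leavesT t
leavesR (cut t s) = leavesT t ++ leavesT s

leaves : Forest → List (Lit × ℕ)
leaves []       = []
leaves (r ∷ Γ) = leavesR r ++ leaves Γ

CutOK : Root → Set
CutOK (fml t)   = ⊤
CutOK (cut t s) = shape s ≡ dualF (shape t)

record Prenet : Set₁ where
  constructor ⟨_⟩_
  field
    links  : ℕ → ℕ → Set
    forest : Forest
open Prenet public

record IsPrenet (N : Prenet) : Set where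
  field
    namesDistinct : Unique (map proj₂ (leaves (forest N)))
    cutsDual      : All CutOK (forest N)
    linkSym       : ∀ u v → links N u v → links N v u
    linkIrrefl    : ∀ u → ¬ links N u u
    linkDual      : ∀ u v → links N u v →
                    ∃[ l ] ((l , u) ∈ leaves (forest N) ×
                            (dualLit l , v) ∈ leaves (forest N))

-- Conjunctive prunings: PruneX x ns  means that ns is the list of
-- leaves retained by some conjunctive pruning of x (one immediate
-- subtree deleted at each ∧-node and each cut node).

data PruneT : Tree → List ℕ → Set where
  pLeaf : ∀ {l n} → PruneT (leaf l n) [ n ]
  pOr   : ∀ {t s xs ys} → PruneT t xs → PruneT s ys → PruneT (t ∨ₜ s) (xs ++ ys)
  pAndL : ∀ {t s xs} → PruneT t xs → PruneT (t ∧ₜ s) xs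
  pAndR : ∀ {t s ys} → PruneT s ys → PruneT (t ∧ₜ s) ys

data PruneR : Root → List ℕ → Set where
  pFml  : ∀ {t xs} → PruneT t xs → PruneR (fml t) xs
  pCutL : ∀ {t s xs} → PruneT t xs → PruneR (cut t s) xs
  pCutR : ∀ {t s ys} → PruneT s ys → PruneR (cut t s) ys

data PruneF : Forest → List ℕ → Set where
  pNil  : PruneF [] []
  pCons : ∀ {r Γ xs ys} → PruneR r xs → PruneF Γ ys → PruneF (r ∷ Γ) (xs ++ ys)

Correct : Prenet → Set
Correct N = ∀ ns → PruneF (forest N) ns →
            ∃[ u ] ∃[ v ] (u ∈ ns × v ∈ ns × links N u v)

k2Links : ℕ → ℕ → (ℕ → ℕ → Set) → ℕ → ℕ → Set
k2Links x y P u v =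
    (u ≢ x × u ≢ y × v ≢ x × v ≢ y × P u v)
  ⊎ (X u × Y v) ⊎ (Y u × X v)
  where
  X : ℕ → Set
  X w = P x w × w ≢ y
  Y : ℕ → Set
  Y w = P y w × w ≢ x

infix 4 _⟶_ _⟶*_ _≈_

data _⟶_ : Prenet → Prenet → Set₁ where
  k1  : ∀ P Γ₁ Γ₂ t₁ t₂ s₁ s₂ →
        ⟨ P ⟩ (Γ₁ ++ cut (t₁ ∧ₜ t₂) (s₁ ∨ₜ s₂) ∷ Γ₂)
          ⟶ ⟨ P ⟩ (Γ₁ ++ cut t₁ s₂ ∷ cut t₂ s₁ ∷ Γ₂)
  -- (K1), cut written with the conjunction on the right:
  -- (B̄ ∨ Ā) ⊘ (A ∧ B)  ↦  Ā ⊘ A , B̄ ⊘ B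
  k1' : ∀ P Γ₁ Γ₂ t₁ t₂ s₁ s₂ →
        ⟨ P ⟩ (Γ₁ ++ cut (s₁ ∨ₜ s₂) (t₁ ∧ₜ t₂) ∷ Γ₂)
          ⟶ ⟨ P ⟩ (Γ₁ ++ cut s₂ t₁ ∷ cut s₁ t₂ ∷ Γ₂)
  k2  : ∀ P Γ₁ Γ₂ l x y →
        ⟨ P ⟩ (Γ₁ ++ cut (leaf l x) (leaf (dualLit l) y) ∷ Γ₂)
          ⟶ ⟨ k2Links x y P ⟩ (Γ₁ ++ Γ₂)

_⟶*_ : Prenet → Prenet → Set₁
_⟶*_ = Star _⟶_

_≈_ : Prenet → Prenet → Set
M ≈ N = forest M ≡ forest N × (∀ u v → (links M u v → links N u v) × (links N u v → links M u v))

PreservesCorrectness : Set₁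
PreservesCorrectness =
  ∀ N N' → IsPrenet N → Correct N → N ⟶ N' → IsPrenet N' × Correct N'

Confluent : Set₁
Confluent =
  ∀ N N₁ N₂ → IsPrenet N → N ⟶* N₁ → N ⟶* N₂ →
  ∃[ M₁ ] ∃[ M₂ ] (N₁ ⟶* M₁ × N₂ ⟶* M₂ × M₁ ≈ M₂)

Terminating : Set₁
Terminating = ∀ N → IsPrenet N → Acc (flip _⟶_) N

-- Every step strictly decreases the total size of the trees under cut nodes,
-- which gives termination.  A (K1) step preserves correctness because every
-- pruning of A ⊘ Ā, B ⊘ B̄ contains the leaves of a pruning of (A ∧ B) ⊘ (B̄ ∨ Ā).
-- For a (K2) step on x ⊘ y, extend a pruning of the reduct once by x and once
-- by y: either one of the two retained links avoids x and y, or they are links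
-- x–u and y–v, and (K2) links u to v.
-- Confluence follows by Newman's lemma up to extensional equality of links:
-- two steps on the same cut coincide and steps on different cuts commute.  For
-- two (K2) steps this needs that in a prenet no leaf is linked to both ends of
-- an atomic cut, since its literal would have to be dual to both a and ā.

module Submission where

open import Defs
open import Data.Bool.Properties using (not-involutive; not-¬)
open import Data.Empty using (⊥; ⊥-elim)
open import Data.Unit using (⊤; tt)
open import Data.Nat using (ℕ; suc; _+_; _<_; s≤s; z≤n)
open import Data.Nat.Properties using (n≤1+n; +-monoʳ-<; +-monoˡ-<; +-assoc)
open import Data.Nat.Induction using (<-wellFounded)
open import Data.Nat.Tactic.RingSolver using (solve-∀)
open import Data.Product using (∃; ∃₂; ∃-syntax; _×_; _,_; proj₁; proj₂; swap)
open import Data.Sum using (_⊎_; inj₁; inj₂)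
open import Data.List using (List; []; _∷_; _++_; [_]; map)
open import Data.List.Properties using (++-assoc; map-++; ∷-injective)
open import Data.List.Membership.Propositional using (_∈_)
open import Data.List.Membership.Propositional.Properties using (∈-map⁺; ∈-++⁺ˡ; ∈-++⁺ʳ; ∈-++⁻)
open import Data.List.Relation.Unary.Any using (here; there)
open import Data.List.Relation.Unary.All using (All; []; _∷_)
import Data.List.Relation.Unary.All as All
import Data.List.Relation.Unary.All.Properties as Allₚ
open import Data.List.Relation.Unary.AllPairs using (_∷_)
open import Data.List.Relation.Unary.Unique.Propositional using (Unique)
open import Data.List.Relation.Binary.Subset.Propositional using (_⊆_)
open import Data.List.Relation.Binary.Subset.Propositional.Properties using (⊆-refl; ⊆-trans)
import Data.List.Relation.Binary.Subset.Propositional.Properties as ⊆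
open import Data.List.Relation.Binary.Permutation.Propositional
  using (_↭_; ↭-refl; ↭-sym; ↭-trans; ↭⇒↭ₛ; module PermutationReasoning)
open import Data.List.Relation.Binary.Permutation.Propositional.Properties
  using (shifts; ∈-resp-↭; ++-commutativeMonoid)
import Data.List.Relation.Binary.Permutation.Propositional.Properties as ↭
open import Data.List.Relation.Binary.Permutation.Setoid.Properties using (Unique-resp-↭)
import Algebra.Solver.CommutativeMonoid as CommutativeMonoidSolver
open import Function using (flip; _∘_)
open import Induction.WellFounded using (WellFounded; Acc; acc; module Subrelation)
open import Relation.Nullary using (¬_)
open import Relation.Binary.Core using (_⇒_; _⇔_)
open import Relation.Binary.Construct.On using (wellFounded)
open import Relation.Binary.Construct.Closure.ReflexiveTransitive using (ε; _◅_; _◅◅_)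
open import Relation.Binary.PropositionalEquality
  using (_≡_; _≢_; ≢-sym; refl; setoid; sym; trans; cong; cong₂; subst; subst₂)

module ++-Solver {A : Set} = CommutativeMonoidSolver (++-commutativeMonoid {A = A})
open ++-Solver using (solve; _⊜_; _⊕_; id)

Links : Set₁
Links = ℕ → ℕ → Set

data Redex : Root → Forest → Set where
  ∧∨-redex     : ∀ t₁ t₂ s₁ s₂ → Redex (cut (t₁ ∧ₜ t₂) (s₁ ∨ₜ s₂)) (cut t₁ s₂ ∷ cut t₂ s₁ ∷ [])
  ∨∧-redex     : ∀ t₁ t₂ s₁ s₂ → Redex (cut (s₁ ∨ₜ s₂) (t₁ ∧ₜ t₂)) (cut s₂ t₁ ∷ cut s₁ t₂ ∷ [])
  atomic-redex : ∀ l x y → Redex (cut (leaf l x) (leaf (dualLit l) y)) []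

contractLinks : ∀ {r o} → Redex r o → Links → Links
contractLinks (atomic-redex _ x y) = k2Links x y
contractLinks (∧∨-redex _ _ _ _)   = λ P → P
contractLinks (∨∧-redex _ _ _ _)   = λ P → P

-- The source forest is a variable constrained by an equation, so that two
-- firings from the same prenet can be matched simultaneously.
data Firing : Prenet → Prenet → Set₁ where
  firing : ∀ P {F} Γ₁ Γ₂ {r o} (ρ : Redex r o) → F ≡ Γ₁ ++ r ∷ Γ₂ →
           Firing (⟨ P ⟩ F) (⟨ contractLinks ρ P ⟩ (Γ₁ ++ o ++ Γ₂))

⟶⇒Firing : ∀ {N N'} → N ⟶ N' → Firing N N'
⟶⇒Firing (k1 P Γ₁ Γ₂ t₁ t₂ s₁ s₂)  = firing P Γ₁ Γ₂ (∧∨-redex t₁ t₂ s₁ s₂) refl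
⟶⇒Firing (k1' P Γ₁ Γ₂ t₁ t₂ s₁ s₂) = firing P Γ₁ Γ₂ (∨∧-redex t₁ t₂ s₁ s₂) refl
⟶⇒Firing (k2 P Γ₁ Γ₂ l x y)        = firing P Γ₁ Γ₂ (atomic-redex l x y) refl

Firing⇒⟶ : ∀ {N N'} → Firing N N' → N ⟶ N'
Firing⇒⟶ (firing P Γ₁ Γ₂ (∧∨-redex t₁ t₂ s₁ s₂) refl) = k1 P Γ₁ Γ₂ t₁ t₂ s₁ s₂
Firing⇒⟶ (firing P Γ₁ Γ₂ (∨∧-redex t₁ t₂ s₁ s₂) refl) = k1' P Γ₁ Γ₂ t₁ t₂ s₁ s₂
Firing⇒⟶ (firing P Γ₁ Γ₂ (atomic-redex l x y) refl)   = k2 P Γ₁ Γ₂ l x y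

-- Termination

treeSize : Tree → ℕ
treeSize (leaf _ _) = 1
treeSize (t ∨ₜ s)   = suc (treeSize t + treeSize s)
treeSize (t ∧ₜ s)   = suc (treeSize t + treeSize s)

rootCutSize : Root → ℕ
rootCutSize (fml _)   = 0
rootCutSize (cut t s) = treeSize t + treeSize s

cutSize : Forest → ℕ
cutSize []      = 0
cutSize (r ∷ Γ) = rootCutSize r + cutSize Γ

cutSize-++ : ∀ Γ Δ → cutSize (Γ ++ Δ) ≡ cutSize Γ + cutSize Δ
cutSize-++ []      Δ = refl
cutSize-++ (r ∷ Γ) Δ =
  trans (cong (rootCutSize r +_) (cutSize-++ Γ Δ)) (sym (+-assoc (rootCutSize r) (cutSize Γ) (cutSize Δ)))

shorter-by-two : ∀ {m n} → 2 + m ≡ n → m < n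
shorter-by-two refl = s≤s (n≤1+n _)

Redex-shrinks : ∀ {r o} → Redex r o → cutSize o < cutSize [ r ]
Redex-shrinks (∧∨-redex t₁ t₂ s₁ s₂) =
  shorter-by-two (sizes (treeSize t₁) (treeSize t₂) (treeSize s₁) (treeSize s₂))
  where
  sizes : ∀ a b c d → 2 + ((a + d) + ((b + c) + 0)) ≡ (suc (a + b) + suc (c + d)) + 0
  sizes = solve-∀
Redex-shrinks (∨∧-redex t₁ t₂ s₁ s₂) =
  shorter-by-two (sizes (treeSize t₁) (treeSize t₂) (treeSize s₁) (treeSize s₂))
  where
  sizes : ∀ a b c d → 2 + ((d + a) + ((c + b) + 0)) ≡ (suc (c + d) + suc (a + b)) + 0
  sizes = solve-∀
Redex-shrinks (atomic-redex _ _ _)   = s≤s z≤n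

Firing-shrinks : ∀ {N N'} → Firing N N' → cutSize (forest N') < cutSize (forest N)
Firing-shrinks (firing _ Γ₁ Γ₂ {r} {o} ρ refl) =
  subst₂ _<_ (sym (sizes o)) (sym (sizes [ r ]))
    (+-monoʳ-< (cutSize Γ₁) (+-monoˡ-< (cutSize Γ₂) (Redex-shrinks ρ)))
  where
  sizes : ∀ Δ → cutSize (Γ₁ ++ Δ ++ Γ₂) ≡ cutSize Γ₁ + (cutSize Δ + cutSize Γ₂)
  sizes Δ = trans (cutSize-++ Γ₁ (Δ ++ Γ₂)) (cong (cutSize Γ₁ +_) (cutSize-++ Δ Γ₂))

⟶-wellFounded : WellFounded (flip _⟶_)
⟶-wellFounded N = Subrelation.accessible (λ s → Firing-shrinks (⟶⇒Firing s))
                    (wellFounded (λ M → cutSize (forest M)) <-wellFounded N)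

-- Leaves and prunings

names : List (Lit × ℕ) → List ℕ
names = map proj₂

⊆-names-++ : ∀ L {L' ns} → ns ⊆ names L ++ names L' → ns ⊆ names (L ++ L')
⊆-names-++ L {L'} {ns} = subst (ns ⊆_) (sym (map-++ proj₂ L L'))

Unique-names-resp-↭ : ∀ {L L'} → L ↭ L' → Unique (names L) → Unique (names L')
Unique-names-resp-↭ p = Unique-resp-↭ (setoid ℕ) (↭⇒↭ₛ (↭.map⁺ proj₂ p))

leaves-++ : ∀ Γ Δ → leaves (Γ ++ Δ) ≡ leaves Γ ++ leaves Δ
leaves-++ []      Δ = refl
leaves-++ (r ∷ Γ) Δ =
  trans (cong (leavesR r ++_) (leaves-++ Γ Δ)) (sym (++-assoc (leavesR r) (leaves Γ) (leaves Δ)))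

leaves-hoist : ∀ Γ₁ Δ Γ₂ → leaves (Γ₁ ++ Δ ++ Γ₂) ↭ leaves Δ ++ leaves (Γ₁ ++ Γ₂)
leaves-hoist Γ₁ Δ Γ₂ = begin
  leaves (Γ₁ ++ Δ ++ Γ₂)              ≡⟨ leaves-++ Γ₁ (Δ ++ Γ₂) ⟩
  leaves Γ₁ ++ leaves (Δ ++ Γ₂)       ≡⟨ cong (leaves Γ₁ ++_) (leaves-++ Δ Γ₂) ⟩
  leaves Γ₁ ++ leaves Δ ++ leaves Γ₂  ↭⟨ shifts (leaves Γ₁) (leaves Δ) ⟩
  leaves Δ ++ leaves Γ₁ ++ leaves Γ₂  ≡⟨ cong (leaves Δ ++_) (leaves-++ Γ₁ Γ₂) ⟨
  leaves Δ ++ leaves (Γ₁ ++ Γ₂)       ∎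
  where open PermutationReasoning

leaves-replace : ∀ Γ₁ Γ₂ {Δ Δ'} → leaves Δ' ↭ leaves Δ → leaves (Γ₁ ++ Δ' ++ Γ₂) ↭ leaves (Γ₁ ++ Δ ++ Γ₂)
leaves-replace Γ₁ Γ₂ {Δ} {Δ'} p =
  ↭-trans (leaves-hoist Γ₁ Δ' Γ₂) (↭-trans (↭.++⁺ʳ _ p) (↭-sym (leaves-hoist Γ₁ Δ Γ₂)))

leaf-in-middle : ∀ Γ₁ Γ₂ {r p} → p ∈ leavesR r → p ∈ leaves (Γ₁ ++ r ∷ Γ₂)
leaf-in-middle Γ₁ Γ₂ {r} p∈ = ∈-resp-↭ (↭-sym (leaves-hoist Γ₁ [ r ] Γ₂)) (∈-++⁺ˡ (∈-++⁺ˡ p∈))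

All-replace : ∀ {Q : Root → Set} Γ₁ {Γ₂ Δ Δ'} → (All Q Δ → All Q Δ') →
              All Q (Γ₁ ++ Δ ++ Γ₂) → All Q (Γ₁ ++ Δ' ++ Γ₂)
All-replace Γ₁ {Δ = Δ} f all with Allₚ.++⁻ Γ₁ all
... | all₁ , all₂ with Allₚ.++⁻ Δ all₂
... | allΔ , all₃ = Allₚ.++⁺ all₁ (Allₚ.++⁺ (f allΔ) all₃)

dualLit-involutive : ∀ l → dualLit (dualLit l) ≡ l
dualLit-involutive (lit p a) = cong (λ q → lit q a) (not-involutive p)

dualLit-≢ : ∀ l → dualLit l ≢ l
dualLit-≢ (lit p a) e = not-¬ refl (sym (cong Lit.pol e))

Unique-names⇒literal-unique : ∀ {L a b n} → Unique (names L) → (a , n) ∈ L → (b , n) ∈ L → a ≡ b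
Unique-names⇒literal-unique _       (here refl) (here refl) = refl
Unique-names⇒literal-unique (n∉ ∷ _) (here refl) (there m)   = ⊥-elim (All.lookup n∉ (∈-map⁺ proj₂ m) refl)
Unique-names⇒literal-unique (n∉ ∷ _) (there m)   (here refl) = ⊥-elim (All.lookup n∉ (∈-map⁺ proj₂ m) refl)
Unique-names⇒literal-unique (_ ∷ u)  (there m)   (there m')  = Unique-names⇒literal-unique u m m'

PruneT-⊆ : ∀ {t ns} → PruneT t ns → ns ⊆ names (leavesT t)
PruneT-⊆ pLeaf             = ⊆-refl
PruneT-⊆ (pOr {t = t} p q) = ⊆-names-++ (leavesT t) (⊆.++⁺ (PruneT-⊆ p) (PruneT-⊆ q))
PruneT-⊆ (pAndL {t = t} p) = ⊆-names-++ (leavesT t) (⊆-trans (PruneT-⊆ p) (⊆.xs⊆xs++ys _ _))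
PruneT-⊆ (pAndR {t = t} q) = ⊆-names-++ (leavesT t) (⊆-trans (PruneT-⊆ q) (⊆.xs⊆ys++xs _ _))

PruneR-⊆ : ∀ {r ns} → PruneR r ns → ns ⊆ names (leavesR r)
PruneR-⊆ (pFml p)          = PruneT-⊆ p
PruneR-⊆ (pCutL {t = t} p) = ⊆-names-++ (leavesT t) (⊆-trans (PruneT-⊆ p) (⊆.xs⊆xs++ys _ _))
PruneR-⊆ (pCutR {t = t} q) = ⊆-names-++ (leavesT t) (⊆-trans (PruneT-⊆ q) (⊆.xs⊆ys++xs _ _))

PruneF-⊆ : ∀ {Γ ns} → PruneF Γ ns → ns ⊆ names (leaves Γ)
PruneF-⊆ pNil                 = ⊆-refl
PruneF-⊆ (pCons {r = r} p ps) = ⊆-names-++ (leavesR r) (⊆.++⁺ (PruneR-⊆ p) (PruneF-⊆ ps))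

PruneF-++⁻ : ∀ Γ {Δ ns} → PruneF (Γ ++ Δ) ns → ∃₂ λ ms ks → PruneF Γ ms × PruneF Δ ks × ns ≡ ms ++ ks
PruneF-++⁻ []      p = [] , _ , pNil , p , refl
PruneF-++⁻ (r ∷ Γ) (pCons {xs = xs} pr p) with PruneF-++⁻ Γ p
... | ms , ks , pms , pks , refl = xs ++ ms , ks , pCons pr pms , pks , sym (++-assoc xs ms ks)

PruneF-++⁺ : ∀ {Γ Δ ms ks} → PruneF Γ ms → PruneF Δ ks → PruneF (Γ ++ Δ) (ms ++ ks)
PruneF-++⁺ pNil                                pks = pks
PruneF-++⁺ (pCons {xs = xs} {ys = ms} pr pms) pks =
  subst (PruneF _) (sym (++-assoc xs ms _)) (pCons pr (PruneF-++⁺ pms pks))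

PruneR-cut-swap : ∀ {t s ns} → PruneR (cut t s) ns → PruneR (cut s t) ns
PruneR-cut-swap (pCutL p) = pCutR p
PruneR-cut-swap (pCutR p) = pCutL p

∈-middle : ∀ {A : Set} (xs : List A) {ys z u} → u ∈ xs ++ z ∷ ys → u ≡ z ⊎ u ∈ xs ++ ys
∈-middle xs m with ∈-++⁻ xs m
... | inj₁ m′         = inj₂ (∈-++⁺ˡ m′)
... | inj₂ (here e)   = inj₁ e
... | inj₂ (there m′) = inj₂ (∈-++⁺ʳ xs m′)

-- Preservation of correctness

IsPrenet-resp-↭ : ∀ {P F F'} → leaves F' ↭ leaves F → All CutOK F' →
                  IsPrenet (⟨ P ⟩ F) → IsPrenet (⟨ P ⟩ F')
IsPrenet-resp-↭ p cuts prenet = record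
  { namesDistinct = Unique-names-resp-↭ (↭-sym p) namesDistinct
  ; cutsDual      = cuts
  ; linkSym       = linkSym
  ; linkIrrefl    = linkIrrefl
  ; linkDual      = λ u v uv → let (l , u∈ , v∈) = linkDual u v uv in
                               l , ∈-resp-↭ (↭-sym p) u∈ , ∈-resp-↭ (↭-sym p) v∈
  }
  where open IsPrenet prenet

IsPrenet-replace : ∀ {P} Γ₁ Γ₂ {Δ Δ'} → leaves Δ' ↭ leaves Δ → (All CutOK Δ → All CutOK Δ') →
                   IsPrenet (⟨ P ⟩ (Γ₁ ++ Δ ++ Γ₂)) → IsPrenet (⟨ P ⟩ (Γ₁ ++ Δ' ++ Γ₂))
IsPrenet-replace Γ₁ Γ₂ p cuts prenet =
  IsPrenet-resp-↭ (leaves-replace Γ₁ Γ₂ p) (All-replace Γ₁ cuts (IsPrenet.cutsDual prenet)) prenet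

∨ᶠ-injective : ∀ {A B C D} → A ∨ᶠ B ≡ C ∨ᶠ D → A ≡ C × B ≡ D
∨ᶠ-injective refl = refl , refl

∧ᶠ-injective : ∀ {A B C D} → A ∧ᶠ B ≡ C ∧ᶠ D → A ≡ C × B ≡ D
∧ᶠ-injective refl = refl , refl

∧∨-leaves : ∀ t₁ t₂ s₁ s₂ → leaves (cut t₁ s₂ ∷ cut t₂ s₁ ∷ []) ↭ leaves [ cut (t₁ ∧ₜ t₂) (s₁ ∨ₜ s₂) ]
∧∨-leaves t₁ t₂ s₁ s₂ =
  solve 4 (λ a b c d → (a ⊕ d) ⊕ ((b ⊕ c) ⊕ id) ⊜ ((a ⊕ b) ⊕ (c ⊕ d)) ⊕ id) ↭-refl
    (leavesT t₁) (leavesT t₂) (leavesT s₁) (leavesT s₂)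

∨∧-leaves : ∀ t₁ t₂ s₁ s₂ → leaves (cut s₂ t₁ ∷ cut s₁ t₂ ∷ []) ↭ leaves [ cut (s₁ ∨ₜ s₂) (t₁ ∧ₜ t₂) ]
∨∧-leaves t₁ t₂ s₁ s₂ =
  solve 4 (λ a b c d → (d ⊕ a) ⊕ ((c ⊕ b) ⊕ id) ⊜ ((c ⊕ d) ⊕ (a ⊕ b)) ⊕ id) ↭-refl
    (leavesT t₁) (leavesT t₂) (leavesT s₁) (leavesT s₂)

∧∨-cuts : ∀ t₁ t₂ s₁ s₂ → All CutOK [ cut (t₁ ∧ₜ t₂) (s₁ ∨ₜ s₂) ] → All CutOK (cut t₁ s₂ ∷ cut t₂ s₁ ∷ [])
∧∨-cuts _ _ _ _ (dual ∷ []) = let (s₁-dual , s₂-dual) = ∨ᶠ-injective dual in s₂-dual ∷ s₁-dual ∷ []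

∨∧-cuts : ∀ t₁ t₂ s₁ s₂ → All CutOK [ cut (s₁ ∨ₜ s₂) (t₁ ∧ₜ t₂) ] → All CutOK (cut s₂ t₁ ∷ cut s₁ t₂ ∷ [])
∨∧-cuts _ _ _ _ (dual ∷ []) = let (t₁-dual , t₂-dual) = ∧ᶠ-injective dual in t₁-dual ∷ t₂-dual ∷ []

Covers : Forest → Forest → Set
Covers Δ' Δ = ∀ {ns} → PruneF Δ' ns → ∃[ ms ] (PruneF Δ ms × ms ⊆ ns)

Correct-replace : ∀ {P} Γ₁ Γ₂ {Δ Δ'} → Covers Δ' Δ →
                  Correct (⟨ P ⟩ (Γ₁ ++ Δ ++ Γ₂)) → Correct (⟨ P ⟩ (Γ₁ ++ Δ' ++ Γ₂))
Correct-replace Γ₁ Γ₂ {Δ' = Δ'} covers correct ns p with PruneF-++⁻ Γ₁ p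
... | as , _ , pas , p′ , refl with PruneF-++⁻ Δ' p′
... | cs , bs , pcs , pbs , refl with covers pcs
... | ms , pms , ms⊆cs with correct _ (PruneF-++⁺ pas (PruneF-++⁺ pms pbs))
... | u , v , u∈ , v∈ , uv = u , v , grow u∈ , grow v∈ , uv
  where
  grow : as ++ ms ++ bs ⊆ as ++ cs ++ bs
  grow = ⊆.++⁺ʳ as (⊆.++⁺ˡ bs ms⊆cs)

∧∨-covers : ∀ {t₁ t₂ s₁ s₂} → Covers (cut t₁ s₂ ∷ cut t₂ s₁ ∷ []) [ cut (t₁ ∧ₜ t₂) (s₁ ∨ₜ s₂) ]
∧∨-covers (pCons (pCutL {xs = ns₁} p₁) (pCons _ pNil)) =
  _ , pCons (pCutL (pAndL p₁)) pNil , ⊆.++⁺ʳ ns₁ (λ ())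
∧∨-covers (pCons (pCutR {ys = ns₂} _) (pCons (pCutL {xs = ns₁} p₂) pNil)) =
  _ , pCons (pCutL (pAndR p₂)) pNil , ⊆.xs⊆ys++xs (ns₁ ++ []) ns₂
∧∨-covers (pCons (pCutR {ys = ns₂} q₂) (pCons (pCutR {ys = ns₁} q₁) pNil)) =
  _ , pCons (pCutR (pOr q₁ q₂)) pNil ,
  ⊆.⊆-reflexive-↭ (solve 2 (λ a b → (a ⊕ b) ⊕ id ⊜ b ⊕ (a ⊕ id)) ↭-refl ns₁ ns₂)

∨∧-covers : ∀ {t₁ t₂ s₁ s₂} → Covers (cut s₂ t₁ ∷ cut s₁ t₂ ∷ []) [ cut (s₁ ∨ₜ s₂) (t₁ ∧ₜ t₂) ]
∨∧-covers (pCons p₁ (pCons p₂ pNil))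
  with ∧∨-covers (pCons (PruneR-cut-swap p₁) (pCons (PruneR-cut-swap p₂) pNil))
... | ms , pCons p pNil , ms⊆ = ms , pCons (PruneR-cut-swap p) pNil , ms⊆

k2Links-sym : ∀ {P : Links} {x y} → (∀ u v → P u v → P v u) →
              ∀ u v → k2Links x y P u v → k2Links x y P v u
k2Links-sym symmetric u v (inj₁ (u≢x , u≢y , v≢x , v≢y , uv)) =
  inj₁ (v≢x , v≢y , u≢x , u≢y , symmetric u v uv)
k2Links-sym symmetric u v (inj₂ (inj₁ (xu , yv)))             = inj₂ (inj₂ (yv , xu))
k2Links-sym symmetric u v (inj₂ (inj₂ (yu , xv)))             = inj₂ (inj₁ (xv , yu))

module AtomicCut {P : Links} {Γ₁ Γ₂ : Forest} {l : Lit} {x y : ℕ}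
                 (prenet : IsPrenet (⟨ P ⟩ (Γ₁ ++ cut (leaf l x) (leaf (dualLit l) y) ∷ Γ₂))) where

  open IsPrenet prenet

  before remaining : List (Lit × ℕ)
  before    = leaves (Γ₁ ++ cut (leaf l x) (leaf (dualLit l) y) ∷ Γ₂)
  remaining = leaves (Γ₁ ++ Γ₂)

  hoisted : before ↭ (l , x) ∷ (dualLit l , y) ∷ remaining
  hoisted = leaves-hoist Γ₁ [ cut (leaf l x) (leaf (dualLit l) y) ] Γ₂

  fresh : Unique (x ∷ y ∷ names remaining)
  fresh = Unique-names-resp-↭ hoisted namesDistinct

  remaining-≢x : ∀ {n} → n ∈ names remaining → n ≢ x
  remaining-≢x m refl with fresh
  ... | (_ ∷ x∉) ∷ _ = All.lookup x∉ m refl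

  remaining-≢y : ∀ {n} → n ∈ names remaining → n ≢ y
  remaining-≢y m refl with fresh
  ... | _ ∷ y∉ ∷ _ = All.lookup y∉ m refl

  remaining-leaf : ∀ {a n} → (a , n) ∈ before → n ≢ x → n ≢ y → (a , n) ∈ remaining
  remaining-leaf m n≢x n≢y with ∈-resp-↭ hoisted m
  ... | here refl          = ⊥-elim (n≢x refl)
  ... | there (here refl)  = ⊥-elim (n≢y refl)
  ... | there (there m′)   = m′

  literal-unique : ∀ {a b n} → (a , n) ∈ before → (b , n) ∈ before → a ≡ b
  literal-unique = Unique-names⇒literal-unique namesDistinct

  partner-of-x : ∀ {u} → P x u → (dualLit l , u) ∈ before
  partner-of-x {u} xu with linkDual x u xu
  ... | _ , x∈ , u∈ = subst (λ k → (dualLit k , u) ∈ before) (literal-unique x∈ x-leaf) u∈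
    where x-leaf = ∈-resp-↭ (↭-sym hoisted) (here refl)

  partner-of-y : ∀ {v} → P y v → (l , v) ∈ before
  partner-of-y {v} yv with linkDual y v yv
  ... | _ , y∈ , v∈ = subst (λ k → (k , v) ∈ before) (dualLit-involutive l)
                         (subst (λ k → (dualLit k , v) ∈ before) (literal-unique y∈ y-leaf) v∈)
    where y-leaf = ∈-resp-↭ (↭-sym hoisted) (there (here refl))

  no-common-partner : ∀ {w} → P x w → P y w → ⊥
  no-common-partner xw yw = dualLit-≢ l (literal-unique (partner-of-x xw) (partner-of-y yw))

  linked-≢ : ∀ {u v} → P u v → u ≢ v
  linked-≢ uv refl = linkIrrefl _ uv

  IsPrenet-contract : IsPrenet (⟨ k2Links x y P ⟩ (Γ₁ ++ Γ₂))
  IsPrenet-contract = record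
    { namesDistinct = drop-xy fresh
    ; cutsDual      = Allₚ.++⁺ cuts₁ cuts₂
    ; linkSym       = k2Links-sym linkSym
    ; linkIrrefl    = irreflexive
    ; linkDual      = dual
    }
    where
    drop-xy : Unique (x ∷ y ∷ names remaining) → Unique (names remaining)
    drop-xy (_ ∷ _ ∷ u) = u
    cuts₁ = proj₁ (Allₚ.++⁻ Γ₁ cutsDual)
    cuts₂ = All.tail (proj₂ (Allₚ.++⁻ Γ₁ cutsDual))
    irreflexive : ∀ u → ¬ k2Links x y P u u
    irreflexive u (inj₁ (_ , _ , _ , _ , uu))         = linkIrrefl u uu
    irreflexive u (inj₂ (inj₁ ((xu , _) , (yu , _)))) = no-common-partner xu yu
    irreflexive u (inj₂ (inj₂ ((yu , _) , (xu , _)))) = no-common-partner xu yu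
    dual : ∀ u v → k2Links x y P u v →
           ∃[ k ] ((k , u) ∈ remaining × (dualLit k , v) ∈ remaining)
    dual u v (inj₁ (u≢x , u≢y , v≢x , v≢y , uv)) =
      let (k , u∈ , v∈) = linkDual u v uv in
      k , remaining-leaf u∈ u≢x u≢y , remaining-leaf v∈ v≢x v≢y
    dual u v (inj₂ (inj₁ ((xu , u≢y) , (yv , v≢x)))) =
      dualLit l ,
      remaining-leaf (partner-of-x xu) (linked-≢ xu ∘ sym) u≢y ,
      remaining-leaf (subst (λ k → (k , v) ∈ before) (sym (dualLit-involutive l)) (partner-of-y yv))
                     v≢x (linked-≢ yv ∘ sym)
    dual u v (inj₂ (inj₂ ((yu , u≢x) , (xv , v≢y)))) =
      l ,
      remaining-leaf (partner-of-y yu) u≢x (linked-≢ yu ∘ sym) ,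
      remaining-leaf (partner-of-x xv) (linked-≢ xv ∘ sym) v≢y

  Correct-contract : Correct (⟨ P ⟩ (Γ₁ ++ cut (leaf l x) (leaf (dualLit l) y) ∷ Γ₂)) →
                     Correct (⟨ k2Links x y P ⟩ (Γ₁ ++ Γ₂))
  Correct-contract correct ns p with PruneF-++⁻ Γ₁ p
  ... | ms , ks , pms , pks , refl = join (survivor x (pCutL pLeaf)) (survivor y (pCutR pLeaf))
    where
    NewLink : Set
    NewLink = ∃₂ λ u v → u ∈ ms ++ ks × v ∈ ms ++ ks × k2Links x y P u v
    Partner : ℕ → Set
    Partner z = ∃[ w ] (w ∈ ms ++ ks × P z w)

    outside : ∀ {w} → w ∈ ms ++ ks → w ≢ x × w ≢ y
    outside w∈ = let w∈′ = PruneF-⊆ (PruneF-++⁺ pms pks) w∈ in remaining-≢x w∈′ , remaining-≢y w∈′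

    survivor : ∀ z → PruneR (cut (leaf l x) (leaf (dualLit l) y)) [ z ] → NewLink ⊎ Partner z
    survivor z pz with correct _ (PruneF-++⁺ pms (pCons pz pks))
    ... | u , v , u∈ , v∈ , uv with ∈-middle ms u∈ | ∈-middle ms v∈
    ... | inj₁ refl | inj₁ refl = ⊥-elim (linkIrrefl u uv)
    ... | inj₁ refl | inj₂ v∈′  = inj₂ (v , v∈′ , uv)
    ... | inj₂ u∈′  | inj₁ refl = inj₂ (u , u∈′ , linkSym u v uv)
    ... | inj₂ u∈′  | inj₂ v∈′  =
      let (u≢x , u≢y) = outside u∈′ ; (v≢x , v≢y) = outside v∈′ in
      inj₁ (u , v , u∈′ , v∈′ , inj₁ (u≢x , u≢y , v≢x , v≢y , uv))

    join : NewLink ⊎ Partner x → NewLink ⊎ Partner y → NewLink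
    join (inj₁ new) _          = new
    join (inj₂ _)   (inj₁ new) = new
    join (inj₂ (u , u∈ , xu)) (inj₂ (v , v∈ , yv)) =
      u , v , u∈ , v∈ , inj₂ (inj₁ ((xu , proj₂ (outside u∈)) , (yv , proj₁ (outside v∈))))

IsPrenet-fire : ∀ P Γ₁ Γ₂ {r o} (ρ : Redex r o) →
                IsPrenet (⟨ P ⟩ (Γ₁ ++ r ∷ Γ₂)) → IsPrenet (⟨ contractLinks ρ P ⟩ (Γ₁ ++ o ++ Γ₂))
IsPrenet-fire P Γ₁ Γ₂ (∧∨-redex t₁ t₂ s₁ s₂) =
  IsPrenet-replace Γ₁ Γ₂ (∧∨-leaves t₁ t₂ s₁ s₂) (∧∨-cuts t₁ t₂ s₁ s₂)
IsPrenet-fire P Γ₁ Γ₂ (∨∧-redex t₁ t₂ s₁ s₂) =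
  IsPrenet-replace Γ₁ Γ₂ (∨∧-leaves t₁ t₂ s₁ s₂) (∨∧-cuts t₁ t₂ s₁ s₂)
IsPrenet-fire P Γ₁ Γ₂ (atomic-redex l x y) prenet = AtomicCut.IsPrenet-contract prenet

Correct-fire : ∀ P Γ₁ Γ₂ {r o} (ρ : Redex r o) → IsPrenet (⟨ P ⟩ (Γ₁ ++ r ∷ Γ₂)) →
               Correct (⟨ P ⟩ (Γ₁ ++ r ∷ Γ₂)) → Correct (⟨ contractLinks ρ P ⟩ (Γ₁ ++ o ++ Γ₂))
Correct-fire P Γ₁ Γ₂ (∧∨-redex _ _ _ _)   _      = Correct-replace Γ₁ Γ₂ ∧∨-covers
Correct-fire P Γ₁ Γ₂ (∨∧-redex _ _ _ _)   _      = Correct-replace Γ₁ Γ₂ ∨∧-covers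
Correct-fire P Γ₁ Γ₂ (atomic-redex _ _ _) prenet = AtomicCut.Correct-contract prenet

preservesCorrectness : PreservesCorrectness
preservesCorrectness N N' prenet correct s with ⟶⇒Firing s
... | firing P Γ₁ Γ₂ ρ refl = IsPrenet-fire P Γ₁ Γ₂ ρ prenet , Correct-fire P Γ₁ Γ₂ ρ prenet correct

IsPrenet-⟶ : ∀ {N N'} → IsPrenet N → N ⟶ N' → IsPrenet N'
IsPrenet-⟶ prenet s with ⟶⇒Firing s
... | firing P Γ₁ Γ₂ ρ refl = IsPrenet-fire P Γ₁ Γ₂ ρ prenet

IsPrenet-⟶* : ∀ {N N'} → IsPrenet N → N ⟶* N' → IsPrenet N'
IsPrenet-⟶* prenet ε        = prenet
IsPrenet-⟶* prenet (s ◅ ss) = IsPrenet-⟶* (IsPrenet-⟶ prenet s) ss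

-- Confluence

≈-refl : ∀ {N} → N ≈ N
≈-refl = refl , λ _ _ → (λ uv → uv) , (λ uv → uv)

≈-sym : ∀ {M N} → M ≈ N → N ≈ M
≈-sym (same-forest , same-links) = sym same-forest , λ u v → swap (same-links u v)

≈-trans : ∀ {M N K} → M ≈ N → N ≈ K → M ≈ K
≈-trans (f₁ , l₁) (f₂ , l₂) =
  trans f₁ f₂ , λ u v → proj₁ (l₂ u v) ∘ proj₁ (l₁ u v) , proj₂ (l₁ u v) ∘ proj₂ (l₂ u v)

contractLinks-mono : ∀ {r o} (ρ : Redex r o) {P Q : Links} → P ⇒ Q → contractLinks ρ P ⇒ contractLinks ρ Q
contractLinks-mono (∧∨-redex _ _ _ _) P⇒Q = P⇒Q
contractLinks-mono (∨∧-redex _ _ _ _) P⇒Q = P⇒Q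
contractLinks-mono (atomic-redex _ _ _) P⇒Q (inj₁ (u≢x , u≢y , v≢x , v≢y , uv)) =
  inj₁ (u≢x , u≢y , v≢x , v≢y , P⇒Q uv)
contractLinks-mono (atomic-redex _ _ _) P⇒Q (inj₂ (inj₁ ((xu , u≢y) , (yv , v≢x)))) =
  inj₂ (inj₁ ((P⇒Q xu , u≢y) , (P⇒Q yv , v≢x)))
contractLinks-mono (atomic-redex _ _ _) P⇒Q (inj₂ (inj₂ ((yu , u≢x) , (xv , v≢y)))) =
  inj₂ (inj₂ ((P⇒Q yu , u≢x) , (P⇒Q xv , v≢y)))

⟶-resp-≈ : ∀ {M M' N} → M ≈ M' → M ⟶ N → ∃[ N' ] (M' ⟶ N' × N ≈ N')
⟶-resp-≈ {M' = M'} (same-forest , same-links) s with ⟶⇒Firing s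
... | firing P Γ₁ Γ₂ ρ refl =
  _ , Firing⇒⟶ (firing (links M') Γ₁ Γ₂ ρ (sym same-forest)) ,
  refl , λ _ _ → contractLinks-mono ρ (proj₁ (same-links _ _)) ,
                 contractLinks-mono ρ (proj₂ (same-links _ _))

⟶*-resp-≈ : ∀ {M M' N} → M ≈ M' → M ⟶* N → ∃[ N' ] (M' ⟶* N' × N ≈ N')
⟶*-resp-≈ M≈M' ε = _ , ε , M≈M'
⟶*-resp-≈ M≈M' (s ◅ ss) with ⟶-resp-≈ M≈M' s
... | _ , s′ , N≈N′ with ⟶*-resp-≈ N≈N′ ss
... | _ , ss′ , K≈K′ = _ , s′ ◅ ss′ , K≈K′

module DisjointAtomicCuts
  {P : Links} {x y x′ y′ : ℕ} (linkSym : ∀ u v → P u v → P v u)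
  (x≢x′ : x ≢ x′) (x≢y′ : x ≢ y′) (y≢x′ : y ≢ x′) (y≢y′ : y ≢ y′)
  (separate : ∀ {w} → P x w → P y w → ⊥) (separate′ : ∀ {w} → P x′ w → P y′ w → ⊥) where

  private
    Q Q′ : Links
    Q  = k2Links x y P
    Q′ = k2Links x′ y′ P

  partners-differ : ∀ {u w} → P x u → P y w → u ≢ w
  partners-differ xu yw refl = separate xu yw

  through-x′y′ : ∀ {u v} → Q x′ u → u ≢ y′ → Q y′ v → v ≢ x′ → k2Links x y Q′ u v
  through-x′y′ (inj₁ (_ , _ , u≢x , u≢y , x′u)) u≢y′ (inj₁ (_ , _ , v≢x , v≢y , y′v)) v≢x′ =
    inj₁ (u≢x , u≢y , v≢x , v≢y , inj₂ (inj₁ ((x′u , u≢y′) , (y′v , v≢x′))))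
  through-x′y′ (inj₁ (_ , _ , u≢x , u≢y , x′u)) u≢y′ (inj₂ (inj₁ ((xy′ , _) , (yv , v≢x)))) v≢x′ =
    inj₂ (inj₁ ((inj₂ (inj₂ ((linkSym _ _ xy′ , x≢x′) , (x′u , u≢y′))) , u≢y) ,
                (inj₁ (y≢x′ , y≢y′ , v≢x′ , ≢-sym (partners-differ xy′ yv) , yv) , v≢x)))
  through-x′y′ (inj₁ (_ , _ , u≢x , u≢y , x′u)) u≢y′ (inj₂ (inj₂ ((yy′ , _) , (xv , v≢y)))) v≢x′ =
    inj₂ (inj₂ ((inj₂ (inj₂ ((linkSym _ _ yy′ , y≢x′) , (x′u , u≢y′))) , u≢x) ,
                (inj₁ (x≢x′ , x≢y′ , v≢x′ , partners-differ xv yy′ , xv) , v≢y)))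
  through-x′y′ (inj₂ (inj₁ ((xx′ , _) , (yu , u≢x)))) u≢y′ (inj₁ (_ , _ , v≢x , v≢y , y′v)) v≢x′ =
    inj₂ (inj₂ ((inj₁ (y≢x′ , y≢y′ , ≢-sym (partners-differ xx′ yu) , u≢y′ , yu) , u≢x) ,
                (inj₂ (inj₁ ((linkSym _ _ xx′ , x≢y′) , (y′v , v≢x′))) , v≢y)))
  through-x′y′ (inj₂ (inj₁ ((xx′ , _) , _))) _ (inj₂ (inj₁ ((xy′ , _) , _))) _ =
    ⊥-elim (separate′ (linkSym _ _ xx′) (linkSym _ _ xy′))
  through-x′y′ (inj₂ (inj₁ ((xx′ , _) , (yu , u≢x)))) u≢y′ (inj₂ (inj₂ ((yy′ , _) , (xv , v≢y)))) v≢x′ =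
    inj₂ (inj₂ ((inj₁ (y≢x′ , y≢y′ , ≢-sym (partners-differ xx′ yu) , u≢y′ , yu) , u≢x) ,
                (inj₁ (x≢x′ , x≢y′ , v≢x′ , partners-differ xv yy′ , xv) , v≢y)))
  through-x′y′ (inj₂ (inj₂ ((yx′ , _) , (xu , u≢y)))) u≢y′ (inj₁ (_ , _ , v≢x , v≢y , y′v)) v≢x′ =
    inj₂ (inj₁ ((inj₁ (x≢x′ , x≢y′ , partners-differ xu yx′ , u≢y′ , xu) , u≢y) ,
                (inj₂ (inj₁ ((linkSym _ _ yx′ , y≢y′) , (y′v , v≢x′))) , v≢x)))
  through-x′y′ (inj₂ (inj₂ ((yx′ , _) , (xu , u≢y)))) u≢y′ (inj₂ (inj₁ ((xy′ , _) , (yv , v≢x)))) v≢x′ =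
    inj₂ (inj₁ ((inj₁ (x≢x′ , x≢y′ , partners-differ xu yx′ , u≢y′ , xu) , u≢y) ,
                (inj₁ (y≢x′ , y≢y′ , v≢x′ , ≢-sym (partners-differ xy′ yv) , yv) , v≢x)))
  through-x′y′ (inj₂ (inj₂ ((yx′ , _) , _))) _ (inj₂ (inj₂ ((yy′ , _) , _))) _ =
    ⊥-elim (separate′ (linkSym _ _ yx′) (linkSym _ _ yy′))

  commute : k2Links x′ y′ Q ⇒ k2Links x y Q′
  commute (inj₁ (u≢x′ , u≢y′ , v≢x′ , v≢y′ , inj₁ (u≢x , u≢y , v≢x , v≢y , uv))) =
    inj₁ (u≢x , u≢y , v≢x , v≢y , inj₁ (u≢x′ , u≢y′ , v≢x′ , v≢y′ , uv))
  commute (inj₁ (u≢x′ , u≢y′ , v≢x′ , v≢y′ , inj₂ (inj₁ ((xu , u≢y) , (yv , v≢x))))) =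
    inj₂ (inj₁ ((inj₁ (x≢x′ , x≢y′ , u≢x′ , u≢y′ , xu) , u≢y) , (inj₁ (y≢x′ , y≢y′ , v≢x′ , v≢y′ , yv) , v≢x)))
  commute (inj₁ (u≢x′ , u≢y′ , v≢x′ , v≢y′ , inj₂ (inj₂ ((yu , u≢x) , (xv , v≢y))))) =
    inj₂ (inj₂ ((inj₁ (y≢x′ , y≢y′ , u≢x′ , u≢y′ , yu) , u≢x) , (inj₁ (x≢x′ , x≢y′ , v≢x′ , v≢y′ , xv) , v≢y)))
  commute (inj₂ (inj₁ ((x′u , u≢y′) , (y′v , v≢x′)))) = through-x′y′ x′u u≢y′ y′v v≢x′
  commute (inj₂ (inj₂ ((y′u , u≢x′) , (x′v , v≢y′)))) =
    k2Links-sym (k2Links-sym linkSym) _ _ (through-x′y′ x′v v≢y′ y′u u≢x′)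

contractLinks-commute : ∀ {P} Γ₁ Ξ Δ₂ {r o r′ o′} (ρ : Redex r o) (ρ′ : Redex r′ o′) →
                        IsPrenet (⟨ P ⟩ (Γ₁ ++ r ∷ Ξ ++ r′ ∷ Δ₂)) →
                        contractLinks ρ′ (contractLinks ρ P) ⇔ contractLinks ρ (contractLinks ρ′ P)
contractLinks-commute _ _ _ (∧∨-redex _ _ _ _)   _                      _ = (λ uv → uv) , (λ uv → uv)
contractLinks-commute _ _ _ (∨∧-redex _ _ _ _)   _                      _ = (λ uv → uv) , (λ uv → uv)
contractLinks-commute _ _ _ (atomic-redex _ _ _) (∧∨-redex _ _ _ _)     _ = (λ uv → uv) , (λ uv → uv)
contractLinks-commute _ _ _ (atomic-redex _ _ _) (∨∧-redex _ _ _ _)     _ = (λ uv → uv) , (λ uv → uv)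
contractLinks-commute {P} Γ₁ Ξ Δ₂ (atomic-redex l x y) (atomic-redex l′ x′ y′) prenet =
  D.commute , D′.commute
  where
  r′ = cut (leaf l′ x′) (leaf (dualLit l′) y′)
  prenet′ : IsPrenet (⟨ P ⟩ ((Γ₁ ++ cut (leaf l x) (leaf (dualLit l) y) ∷ Ξ) ++ r′ ∷ Δ₂))
  prenet′ = subst (λ F → IsPrenet (⟨ P ⟩ F)) (sym (++-assoc Γ₁ _ (r′ ∷ Δ₂))) prenet
  module A  = AtomicCut prenet
  module A′ = AtomicCut prenet′
  remains : ∀ {p} → p ∈ leavesR r′ → proj₂ p ∈ names A.remaining
  remains p∈ =
    ∈-map⁺ proj₂ (subst (λ F → _ ∈ leaves F) (++-assoc Γ₁ Ξ (r′ ∷ Δ₂)) (leaf-in-middle (Γ₁ ++ Ξ) Δ₂ p∈))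
  x′-remains = remains (here refl)
  y′-remains = remains (there (here refl))
  module D = DisjointAtomicCuts (IsPrenet.linkSym prenet)
    (≢-sym (A.remaining-≢x x′-remains)) (≢-sym (A.remaining-≢x y′-remains))
    (≢-sym (A.remaining-≢y x′-remains)) (≢-sym (A.remaining-≢y y′-remains))
    A.no-common-partner A′.no-common-partner
  module D′ = DisjointAtomicCuts (IsPrenet.linkSym prenet)
    (A.remaining-≢x x′-remains) (A.remaining-≢y x′-remains)
    (A.remaining-≢x y′-remains) (A.remaining-≢y y′-remains)
    A′.no-common-partner A.no-common-partner

data Occurrences {A : Set} (Γ₁ : List A) (r : A) (Γ₂ Δ₁ : List A) (r′ : A) (Δ₂ : List A) : Set where
  same  : Γ₁ ≡ Δ₁ → r ≡ r′ → Γ₂ ≡ Δ₂ → Occurrences Γ₁ r Γ₂ Δ₁ r′ Δ₂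
  left  : ∀ Ξ → Δ₁ ≡ Γ₁ ++ r ∷ Ξ → Γ₂ ≡ Ξ ++ r′ ∷ Δ₂ → Occurrences Γ₁ r Γ₂ Δ₁ r′ Δ₂
  right : ∀ Ξ → Γ₁ ≡ Δ₁ ++ r′ ∷ Ξ → Δ₂ ≡ Ξ ++ r ∷ Γ₂ → Occurrences Γ₁ r Γ₂ Δ₁ r′ Δ₂

occurrences : ∀ {A : Set} (Γ₁ Δ₁ : List A) {r r′ Γ₂ Δ₂} →
              Γ₁ ++ r ∷ Γ₂ ≡ Δ₁ ++ r′ ∷ Δ₂ → Occurrences Γ₁ r Γ₂ Δ₁ r′ Δ₂
occurrences []       []       refl = same refl refl refl
occurrences []       (_ ∷ Δ₁) refl = left Δ₁ refl refl
occurrences (_ ∷ Γ₁) []       refl = right Γ₁ refl refl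
occurrences (a ∷ Γ₁) (b ∷ Δ₁) e with ∷-injective e
... | a≡b , e′ with occurrences Γ₁ Δ₁ e′
...   | same  p q s  = same (cong₂ _∷_ a≡b p) q s
...   | left  Ξ p q  = left Ξ (cong₂ _∷_ (sym a≡b) p) q
...   | right Ξ p q  = right Ξ (cong₂ _∷_ a≡b p) q

Joinable : Prenet → Prenet → Set₁
Joinable N₁ N₂ = ∃[ M₁ ] ∃[ M₂ ] (N₁ ⟶* M₁ × N₂ ⟶* M₂ × M₁ ≈ M₂)

Joinable-sym : ∀ {N₁ N₂} → Joinable N₁ N₂ → Joinable N₂ N₁
Joinable-sym (M₁ , M₂ , ss₁ , ss₂ , M₁≈M₂) = M₂ , M₁ , ss₂ , ss₁ , ≈-sym M₁≈M₂

same-redex-joinable : ∀ P Γ₁ Γ₂ {r o o′} (ρ : Redex r o) (ρ′ : Redex r o′) →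
                      Joinable (⟨ contractLinks ρ P ⟩ (Γ₁ ++ o ++ Γ₂)) (⟨ contractLinks ρ′ P ⟩ (Γ₁ ++ o′ ++ Γ₂))
same-redex-joinable _ _ _ (∧∨-redex _ _ _ _)   (∧∨-redex _ _ _ _)   = _ , _ , ε , ε , ≈-refl
same-redex-joinable _ _ _ (∨∧-redex _ _ _ _)   (∨∧-redex _ _ _ _)   = _ , _ , ε , ε , ≈-refl
same-redex-joinable _ _ _ (atomic-redex _ _ _) (atomic-redex _ _ _) = _ , _ , ε , ε , ≈-refl

disjoint-redexes-joinable : ∀ P Γ₁ Ξ Δ₂ {r o r′ o′} (ρ : Redex r o) (ρ′ : Redex r′ o′) →
  IsPrenet (⟨ P ⟩ (Γ₁ ++ r ∷ Ξ ++ r′ ∷ Δ₂)) →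
  Joinable (⟨ contractLinks ρ P ⟩ (Γ₁ ++ o ++ Ξ ++ r′ ∷ Δ₂)) (⟨ contractLinks ρ′ P ⟩ ((Γ₁ ++ r ∷ Ξ) ++ o′ ++ Δ₂))
disjoint-redexes-joinable P Γ₁ Ξ Δ₂ {r} {o} {r′} {o′} ρ ρ′ prenet =
  _ , _ ,
  Firing⇒⟶ (firing _ (Γ₁ ++ o ++ Ξ) Δ₂ ρ′ (sym (reassoc (r′ ∷ Δ₂)))) ◅ ε ,
  Firing⇒⟶ (firing _ Γ₁ (Ξ ++ o′ ++ Δ₂) ρ (++-assoc Γ₁ (r ∷ Ξ) (o′ ++ Δ₂))) ◅ ε ,
  reassoc (o′ ++ Δ₂) , λ _ _ → proj₁ commute , proj₂ commute
  where
  reassoc : ∀ Z → (Γ₁ ++ o ++ Ξ) ++ Z ≡ Γ₁ ++ o ++ Ξ ++ Z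
  reassoc Z = trans (++-assoc Γ₁ (o ++ Ξ) Z) (cong (Γ₁ ++_) (++-assoc o Ξ Z))
  commute = contractLinks-commute Γ₁ Ξ Δ₂ ρ ρ′ prenet

local-confluence : ∀ {N N₁ N₂} → IsPrenet N → N ⟶ N₁ → N ⟶ N₂ → Joinable N₁ N₂
local-confluence prenet s₁ s₂ with ⟶⇒Firing s₁ | ⟶⇒Firing s₂
... | firing P Γ₁ Γ₂ ρ refl | firing _ Δ₁ Δ₂ ρ′ e with occurrences Γ₁ Δ₁ e
...   | same refl refl refl = same-redex-joinable P Γ₁ Γ₂ ρ ρ′
...   | left Ξ refl refl    = disjoint-redexes-joinable P Γ₁ Ξ Δ₂ ρ ρ′ prenet
...   | right Ξ refl refl   =
  Joinable-sym (disjoint-redexes-joinable P Δ₁ Ξ Γ₂ ρ′ ρ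
    (subst (λ F → IsPrenet (⟨ P ⟩ F)) (++-assoc Δ₁ (_ ∷ Ξ) (_ ∷ Γ₂)) prenet))

Normal : Prenet → Set₁
Normal N = ∀ {N'} → ¬ (N ⟶ N')

Normal-resp-≈ : ∀ {M M'} → M ≈ M' → Normal M → Normal M'
Normal-resp-≈ M≈M' normal s = normal (proj₁ (proj₂ (⟶-resp-≈ (≈-sym M≈M') s)))

IsFormula : Root → Set
IsFormula (fml _)   = ⊤
IsFormula (cut _ _) = ⊥

Redex-not-formula : ∀ {r o} → Redex r o → ¬ IsFormula r
Redex-not-formula (∧∨-redex _ _ _ _)   ()
Redex-not-formula (∨∧-redex _ _ _ _)   ()
Redex-not-formula (atomic-redex _ _ _) ()

cut-free-normal : ∀ {N} → All IsFormula (forest N) → Normal N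
cut-free-normal formulas s with ⟶⇒Firing s
... | firing _ Γ₁ _ ρ refl with Allₚ.++⁻ʳ Γ₁ formulas
...   | formula ∷ _ = Redex-not-formula ρ formula

cut-or-cut-free : ∀ F → (∃₂ λ Γ₁ Γ₂ → ∃₂ λ t s → F ≡ Γ₁ ++ cut t s ∷ Γ₂) ⊎ All IsFormula F
cut-or-cut-free []            = inj₂ []
cut-or-cut-free (cut t s ∷ F) = inj₁ ([] , F , t , s , refl)
cut-or-cut-free (fml t ∷ F) with cut-or-cut-free F
... | inj₁ (Γ₁ , Γ₂ , t′ , s , refl) = inj₁ (fml t ∷ Γ₁ , Γ₂ , t′ , s , refl)
... | inj₂ formulas                  = inj₂ (tt ∷ formulas)

dual-cut-redex : ∀ t s → CutOK (cut t s) → ∃ (Redex (cut t s))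
dual-cut-redex (leaf l x) (leaf _ y)  refl = _ , atomic-redex l x y
dual-cut-redex (t₁ ∧ₜ t₂) (s₁ ∨ₜ s₂)  _    = _ , ∧∨-redex t₁ t₂ s₁ s₂
dual-cut-redex (t₁ ∨ₜ t₂) (s₁ ∧ₜ s₂)  _    = _ , ∨∧-redex s₁ s₂ t₁ t₂
dual-cut-redex (leaf _ _) (_ ∨ₜ _)    ()
dual-cut-redex (leaf _ _) (_ ∧ₜ _)    ()
dual-cut-redex (_ ∨ₜ _)   (leaf _ _)  ()
dual-cut-redex (_ ∨ₜ _)   (_ ∨ₜ _)    ()
dual-cut-redex (_ ∧ₜ _)   (leaf _ _)  ()
dual-cut-redex (_ ∧ₜ _)   (_ ∧ₜ _)    ()

progress : ∀ {N} → IsPrenet N → Normal N ⊎ ∃[ N' ] N ⟶ N'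
progress {⟨ P ⟩ F} prenet with cut-or-cut-free F
... | inj₂ formulas = inj₁ (cut-free-normal formulas)
... | inj₁ (Γ₁ , Γ₂ , t , s , refl) with Allₚ.++⁻ʳ Γ₁ (IsPrenet.cutsDual prenet)
...   | dual ∷ _ = let (_ , ρ) = dual-cut-redex t s dual in inj₂ (_ , Firing⇒⟶ (firing P Γ₁ Γ₂ ρ refl))

normalise : ∀ {N} → IsPrenet N → ∃[ M ] (N ⟶* M × Normal M)
normalise {N} prenet = go prenet (⟶-wellFounded N)
  where
  go : ∀ {N} → IsPrenet N → Acc (flip _⟶_) N → ∃[ M ] (N ⟶* M × Normal M)
  go prenet (acc rs) with progress prenet
  ... | inj₁ normal = _ , ε , normal
  ... | inj₂ (_ , s) with go (IsPrenet-⟶ prenet s) (rs s)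
  ...   | M , ss , normal = M , s ◅ ss , normal

-- Relation.Binary.Rewriting.sn&wcr⇒cr needs joins up to _≡_, whereas here
-- links agree only extensionally.
normal-forms-unique : ∀ {N M₁ M₂} → IsPrenet N → Acc (flip _⟶_) N →
                      N ⟶* M₁ → Normal M₁ → N ⟶* M₂ → Normal M₂ → M₁ ≈ M₂
normal-forms-unique _ _ ε       _       ε       _       = ≈-refl
normal-forms-unique _ _ ε       normal₁ (s ◅ _) _       = ⊥-elim (normal₁ s)
normal-forms-unique _ _ (s ◅ _) _       ε       normal₂ = ⊥-elim (normal₂ s)
normal-forms-unique prenet (acc rs) (s₁ ◅ ss₁) normal₁ (s₂ ◅ ss₂) normal₂
  with local-confluence prenet s₁ s₂
... | K₁ , K₂ , ts₁ , ts₂ , K₁≈K₂ with normalise (IsPrenet-⟶* (IsPrenet-⟶ prenet s₁) ts₁)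
... | M , us , normal with ⟶*-resp-≈ K₁≈K₂ us
... | M′ , us′ , M≈M′ =
  ≈-trans (normal-forms-unique (IsPrenet-⟶ prenet s₁) (rs s₁) ss₁ normal₁ (ts₁ ◅◅ us) normal)
    (≈-trans M≈M′
      (normal-forms-unique (IsPrenet-⟶ prenet s₂) (rs s₂) (ts₂ ◅◅ us′) (Normal-resp-≈ M≈M′ normal) ss₂ normal₂))

confluent : Confluent
confluent N N₁ N₂ prenet ss₁ ss₂
  with normalise (IsPrenet-⟶* prenet ss₁) | normalise (IsPrenet-⟶* prenet ss₂)
... | M₁ , ts₁ , normal₁ | M₂ , ts₂ , normal₂ =
  M₁ , M₂ , ts₁ , ts₂ ,
  normal-forms-unique prenet (⟶-wellFounded N) (ss₁ ◅◅ ts₁) normal₁ (ss₂ ◅◅ ts₂) normal₂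

theorem5p10 : PreservesCorrectness × Confluent × Terminating
theorem5p10 = preservesCorrectness , confluent , λ N _ → ⟶-wellFounded N
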